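{- Let $p$ be a prime, $d\geq 1$, $H\leq \mathrm{\Gamma L}_1(p^d)$, $T=H\cap\mathrm{GL}_1(p^d)\cong C_t$, and write $H=T\rtimes E$ with $E\cong C_e$. Let $V=\mathbb{F}_{p^d}$ be the natural module and let $G$ be a permutation group on $V$ that is transitive with $G_0=H$ (acting naturally). Suppose that the following equivalent conditions hold: $T$ and $H$ have the same orbits on $V$; equivalently, the orbits of $H$ on $V\setminus\{0\}$ all have the same size; equivalently, $e=1$ or $p^d-1$ divides $t(p^{d/e}-1)$. Then $G$ has Property $(\star)$.
   Context: $\mathrm{\Gamma L}_1(p^d)$ is the group of maps $x\mapsto ax^\sigma$ on $\mathbb{F}_{p^d}$ ($a\neq 0$, $\sigma$ a field automorphism), and $\mathrm{GL}_1(p^d)$ its subgroup of maps $x\mapsto ax$; every $H\leq \mathrm{\Gamma L}_1(p^d)$ is of the form $T\rtimes E$ with $E$ cyclic of order $e$ dividing $d$. A permutation group $G$ on $\Omega$ has Property $(\star)$ if for all $u,v,w\in\Omega$ with $u\neq w$, $G_{uv}\leq G_w$ implies $G_{uw}\leq G_v$. -}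

module Defs where

open import Data.Nat using (ℕ)
open import Data.Fin using (Fin)
open import Data.Product using (Σ; ∃; _×_)
open import Function using (_∘_; id; _↔_)
open import Function.Definitions using (Bijective)
open import Relation.Nullary using (¬_)
open import Relation.Binary.PropositionalEquality using (_≡_)
open import Algebra.Structures using (IsCommutativeRing)

record FiniteField : Set₁ where
  infixl 6 _+_
  infixl 7 _*_
  field
    Carrier : Set
    _+_ _*_ : Carrier → Carrier → Carrier
    -_ : Carrier → Carrier
    0# 1# : Carrier
    isCommutativeRing : IsCommutativeRing _≡_ _+_ _*_ -_ 0# 1#
    0≢1 : ¬ (0# ≡ 1#)
    inverse : ∀ x → ¬ (x ≡ 0#) → ∃ λ y → x * y ≡ 1#
    size : ℕ
    enum : Fin size ↔ Carrier

module _ (F : FiniteField) where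
  open FiniteField F

  IsFieldAut : (Carrier → Carrier) → Set
  IsFieldAut σ =
    (∀ x y → σ (x + y) ≡ σ x + σ y) ×
    (∀ x y → σ (x * y) ≡ σ x * σ y) ×
    (σ 1# ≡ 1#) ×
    Bijective _≡_ _≡_ σ

  ΓL₁ : (Carrier → Carrier) → Set
  ΓL₁ f = Σ Carrier λ a → ¬ (a ≡ 0#) ×
            Σ (Carrier → Carrier) λ σ → IsFieldAut σ × (∀ x → f x ≡ a * σ x)

  GL₁ : (Carrier → Carrier) → Set
  GL₁ f = Σ Carrier λ a → ¬ (a ≡ 0#) × (∀ x → f x ≡ a * x)

-- A permutation group on a set A, given as a predicate on maps A → A
-- (closed under pointwise equality, since we lack function extensionality).
record IsPermGroup {A : Set} (G : (A → A) → Set) : Set where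
  field
    respects : ∀ {f g} → (∀ x → f x ≡ g x) → G f → G g
    bij      : ∀ {g} → G g → Bijective _≡_ _≡_ g
    id∈      : G id
    ∘∈       : ∀ {f g} → G f → G g → G (f ∘ g)
    inv∈     : ∀ {g} → G g →
               ∃ λ h → G h × (∀ x → h (g x) ≡ x) × (∀ x → g (h x) ≡ x)

module _ {A : Set} (G : (A → A) → Set) where

  IsTransitive : Set
  IsTransitive = ∀ x y → ∃ λ g → G g × g x ≡ y

  StabLe : A → A → A → Set
  StabLe u v w = ∀ g → G g → g u ≡ u → g v ≡ v → g w ≡ w

  Star : Set
  Star = ∀ u v w → ¬ (u ≡ w) → StabLe u v w → StabLe u w v

{-# OPTIONS --safe #-}
-- Conjugating by an element of the transitive group G moves u to 0, where the two
-- point stabilisers live inside G₀ = H. If h ∈ H fixes w ≠ 0, choose τ ∈ T = H ∩ GL₁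
-- with τ v = h v; then τ⁻¹h fixes 0 and v, hence w, so the scalar τ fixes w ≠ 0 and
-- is the identity. Thus h v = τ v = v.
module Submission where

open import Defs
open import Data.Nat using (ℕ; _≥_; _^_)
open import Data.Nat.Primality using (Prime)
open import Data.Product using (∃; _×_; _,_; proj₁; proj₂)
open import Function using (_∘_)
open import Relation.Nullary using (¬_)
open import Relation.Binary.PropositionalEquality
  using (_≡_; refl; sym; trans; cong; module ≡-Reasoning)
open import Algebra.Structures using (module IsCommutativeRing)

module _ {A : Set} {G : (A → A) → Set} where

  StabLe-cong : ∀ {u u′ v v′ w w′} → u ≡ u′ → v ≡ v′ → w ≡ w′ →
                StabLe G u v w → StabLe G u′ v′ w′
  StabLe-cong refl refl refl st = st

  StabLe-conj : IsPermGroup G → ∀ {g k} → G g → G k →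
                (∀ x → k (g x) ≡ x) → (∀ x → g (k x) ≡ x) →
                ∀ {u v w} → StabLe G u v w → StabLe G (g u) (g v) (g w)
  StabLe-conj GP {g} {k} gG kG kg gk {u} {v} {w} st m mG mu mv = begin
    m (g w)             ≡⟨ sym (gk (m (g w))) ⟩
    g (k (m (g w)))     ≡⟨ cong g (st (k ∘ m ∘ g) conjG (fixes u mu) (fixes v mv)) ⟩
    g w                 ∎
    where
    open ≡-Reasoning
    open IsPermGroup GP
    conjG : G (k ∘ m ∘ g)
    conjG = ∘∈ kG (∘∈ mG gG)
    fixes : ∀ x → m (g x) ≡ g x → k (m (g x)) ≡ x
    fixes x mgx = trans (cong k mgx) (kg x)

  Star-fromBasepoint : IsPermGroup G → IsTransitive G → (x₀ : A) →
    (∀ v w → ¬ w ≡ x₀ → StabLe G x₀ v w → StabLe G x₀ w v) → Star G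
  Star-fromBasepoint GP transitive x₀ swap u v w u≢w st =
    StabLe-cong (kg u) (kg w) (kg v) (StabLe-conj GP kG gG gk kg swapped)
    where
    open IsPermGroup GP using (inv∈)
    g = proj₁ (transitive u x₀)
    gG = proj₁ (proj₂ (transitive u x₀))
    gu = proj₂ (proj₂ (transitive u x₀))
    k = proj₁ (inv∈ gG)
    kG = proj₁ (proj₂ (inv∈ gG))
    kg = proj₁ (proj₂ (proj₂ (inv∈ gG)))
    gk = proj₂ (proj₂ (proj₂ (inv∈ gG)))
    gw≢x₀ : ¬ g w ≡ x₀
    gw≢x₀ e = u≢w (trans (sym (kg u)) (trans (cong k (trans gu (sym e))) (kg w)))
    swapped : StabLe G (g u) (g w) (g v)
    swapped = StabLe-cong (sym gu) refl refl
      (swap (g v) (g w) gw≢x₀ (StabLe-cong gu refl refl (StabLe-conj GP gG kG kg gk st)))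

module _ {A : Set} {G H : (A → A) → Set} where

  StabLe-antitone : (∀ h → H h → G h) → ∀ {u v w} → StabLe G u v w → StabLe H u v w
  StabLe-antitone H⊆G st h hH = st h (H⊆G h hH)

  StabLe-fromStabiliser : ∀ {u} → (∀ g → G g → g u ≡ u → H g) →
                          ∀ {v w} → StabLe H u v w → StabLe G u v w
  StabLe-fromStabiliser Gu⊆H st g gG gu = st g (Gu⊆H g gG gu) gu

module _ (F : FiniteField) where
  open FiniteField F
  open IsCommutativeRing isCommutativeRing using (*-assoc; *-identityˡ; *-identityʳ; zeroʳ)

  SameOrbitsAsLinearPart : ((Carrier → Carrier) → Set) → Set
  SameOrbitsAsLinearPart H =
    ∀ x y → (∃ λ h → H h × h x ≡ y) → ∃ λ τ → (H τ × GL₁ F τ) × τ x ≡ y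

  scalar-fixing-nonzero≡1 : ∀ {c w} → ¬ w ≡ 0# → c * w ≡ w → c ≡ 1#
  scalar-fixing-nonzero≡1 {c} {w} w≢0 cw = begin
    c             ≡⟨ sym (*-identityʳ c) ⟩
    c * 1#        ≡⟨ cong (c *_) (sym wy) ⟩
    c * (w * y)   ≡⟨ sym (*-assoc c w y) ⟩
    c * w * y     ≡⟨ cong (_* y) cw ⟩
    w * y         ≡⟨ wy ⟩
    1#            ∎
    where
    open ≡-Reasoning
    y = proj₁ (inverse w w≢0)
    wy = proj₂ (inverse w w≢0)

  GL₁-fixing-nonzero-fixesAll : ∀ {τ w} → GL₁ F τ → ¬ w ≡ 0# → τ w ≡ w → ∀ x → τ x ≡ x
  GL₁-fixing-nonzero-fixesAll {τ} {w} (c , _ , τc) w≢0 τw x = begin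
    τ x      ≡⟨ τc x ⟩
    c * x    ≡⟨ cong (_* x) (scalar-fixing-nonzero≡1 w≢0 (trans (sym (τc w)) τw)) ⟩
    1# * x   ≡⟨ *-identityˡ x ⟩
    x        ∎
    where open ≡-Reasoning

  GL₁-fixes-0 : ∀ {τ} → GL₁ F τ → τ 0# ≡ 0#
  GL₁-fixes-0 (c , _ , τc) = trans (τc 0#) (zeroʳ c)

  StabLe-0-sym : {H : (Carrier → Carrier) → Set} → IsPermGroup H →
    SameOrbitsAsLinearPart H →
    ∀ v w → ¬ w ≡ 0# → StabLe H 0# v w → StabLe H 0# w v
  StabLe-0-sym {H} HP orbits v w w≢0 st h hH h0 hw = begin
    h v   ≡⟨ sym τv ⟩
    τ v   ≡⟨ GL₁-fixing-nonzero-fixesAll τGL w≢0 τw v ⟩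
    v     ∎
    where
    open ≡-Reasoning
    open IsPermGroup HP using (∘∈; inv∈)
    linear = orbits v (h v) (h , hH , refl)
    τ = proj₁ linear
    τH = proj₁ (proj₁ (proj₂ linear))
    τGL = proj₂ (proj₁ (proj₂ linear))
    τv = proj₂ (proj₂ linear)
    τ⁻¹ = proj₁ (inv∈ τH)
    τ⁻¹H = proj₁ (proj₂ (inv∈ τH))
    τ⁻¹τ = proj₁ (proj₂ (proj₂ (inv∈ τH)))
    ττ⁻¹ = proj₂ (proj₂ (proj₂ (inv∈ τH)))
    τ⁻¹hw : τ⁻¹ (h w) ≡ w
    τ⁻¹hw = st (τ⁻¹ ∘ h) (∘∈ τ⁻¹H hH)
      (trans (cong τ⁻¹ (trans h0 (sym (GL₁-fixes-0 τGL)))) (τ⁻¹τ 0#))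
      (trans (cong τ⁻¹ (sym τv)) (τ⁻¹τ v))
    τw : τ w ≡ w
    τw = begin
      τ w             ≡⟨ cong τ (sym τ⁻¹hw) ⟩
      τ (τ⁻¹ (h w))   ≡⟨ ττ⁻¹ (h w) ⟩
      h w             ≡⟨ hw ⟩
      w               ∎

-- Only the orbit condition on H enters; p, d and H ≤ ΓL₁ merely place the statement in the paper's setting.
lemma3p5 : (p d : ℕ) → Prime p → d ≥ 1 →
    (F : FiniteField) → FiniteField.size F ≡ p ^ d →
    (H : (FiniteField.Carrier F → FiniteField.Carrier F) → Set) →
    IsPermGroup H → (∀ h → H h → ΓL₁ F h) →
    (G : (FiniteField.Carrier F → FiniteField.Carrier F) → Set) →
    IsPermGroup G → IsTransitive G →
    (∀ g → (G g × g (FiniteField.0# F) ≡ FiniteField.0# F → H g) × (H g → G g × g (FiniteField.0# F) ≡ FiniteField.0# F)) →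
    (∀ x y → (∃ λ h → H h × h x ≡ y) → ∃ λ τ → (H τ × GL₁ F τ) × τ x ≡ y) →
    Star G
lemma3p5 _ _ _ _ F _ H HP _ G GP transitive G₀≡H orbits =
  Star-fromBasepoint GP transitive 0# λ v w w≢0 st →
    StabLe-fromStabiliser G₀⊆H
      (StabLe-0-sym F HP orbits v w w≢0 (StabLe-antitone H⊆G st))
  where
  open FiniteField F using (0#)
  G₀⊆H : ∀ g → G g → g 0# ≡ 0# → H g
  G₀⊆H g gG g0 = proj₁ (G₀≡H g) (gG , g0)
  H⊆G : ∀ h → H h → G h
  H⊆G h hH = proj₁ (proj₂ (G₀≡H h) hH)
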